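{- Let $a$, $d$, $z$ be positive integers. Then \begin{align*} [a]_{q^{d+1}}[d]_q[z+a]_q = {}&q^a[a]_{q^d}[d-1]_q[z]_q+q^{a-1}wt_{q,q^{ -1}}(a)[z+da]_q\\ &-q^a(1-q)(1-q^{ -1})\sum_{k=1}^{a-1}wt_{q,q^{ -1}}(k)[a-k]_{q^d}[d-1]_q[z+dk]_q. \end{align*}
   Context: $[k]_x=1+x+\dots+x^{k-1}$ (with $[0]_x=0$), and $wt_{q,q^{ -1}}(k)=\frac{q^k-q^{ -k}}{q-q^{ -1}}$ for $k>0$. -}

module Defs where

open import Level using (Level)
open import Data.Nat using (ℕ; zero; suc; _∸_)
open import Algebra.Bundles using (CommutativeRing)

module QCalc {c ℓ : Level} (R : CommutativeRing c ℓ) where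
  open CommutativeRing R

  pow : Carrier → ℕ → Carrier
  pow x zero    = 1#
  pow x (suc n) = x * pow x n

  qint : Carrier → ℕ → Carrier
  qint x zero    = 0#
  qint x (suc k) = qint x k + pow x k

  -- wt_{q,q^{-1}}(k) = (q^k - q^{-k})/(q - q^{-1})
  --                  = sum_{j=0}^{k-1} q^(k-1-j) (q^{-1})^j   (Laurent polynomial)
  -- here qi plays the role of q^{-1}
  wtAux : Carrier → Carrier → ℕ → ℕ → Carrier
  wtAux q qi k zero    = 0#
  wtAux q qi k (suc j) = wtAux q qi k j + pow q (k ∸ 1 ∸ j) * pow qi j

  wt : Carrier → Carrier → ℕ → Carrier
  wt q qi k = wtAux q qi k k

  sum1 : (ℕ → Carrier) → ℕ → Carrier
  sum1 f zero    = 0#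
  sum1 f (suc n) = sum1 f n + f (suc n)

-- Regard both sides as sequences in a. The left side L = [a]_{q^(d+1)} [d]_q [z+a]_q is a product of
-- two sums that are affine in (q^(d+1))^a and in q^a, so it satisfies the second-order recurrence with
-- characteristic roots q and q^(d+1), up to an explicit inhomogeneity. On the right, the first term is
-- of the same kind, and the correction sum is a convolution against [a-k]_{q^d}, so multiplied by q^a
-- it satisfies that recurrence with a boundary term. The middle term q^(a-1) wt(a) [z+da]_q equals
-- [a]_{q^2} [z+da]_q, whose natural roots are q^2 and q^d instead; the price of the change of roots is
-- (q^2 + q^d - q - q^(d+1)) times the term at a+1, and since this factor is q^2 (1-q)(1-q^(-1)) [d-1]_q
-- it is exactly the boundary term of the correction sum. Both sides therefore obey the same
-- recurrence, and they agree at a = 0 and a = 1.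

module Submission where

open import Defs
open import Level using (Level)
open import Data.Nat using (ℕ; zero; suc; _∸_; NonZero)
import Data.Nat as N
open import Algebra.Bundles using (CommutativeRing)

import Data.Nat.Properties as NP
open import Data.Integer as ℤ using (ℤ; +_; -[1+_]; _⊖_)
import Data.Integer.Properties as ℤP
open import Data.Sign as Sign using (Sign)
open import Data.Maybe using (Maybe; just; nothing)
open import Relation.Nullary using (yes; no)
import Relation.Binary.PropositionalEquality as ≡
open import Algebra.Solver.Ring.AlmostCommutativeRing
  using (_-Raw-AlmostCommutative⟶_; fromCommutativeRing)
import Algebra.Solver.Ring

-- Constants go through the optimised _×_, for which 0 × 1# and 1 × 1# reduce to 0# and 1#,
-- so the sides the solver produces match the goals definitionally.
module IntegerCoefficients {c ℓ : Level} (R : CommutativeRing c ℓ) where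
  open CommutativeRing R
  open import Algebra.Properties.Ring ring
    using (-‿involutive; -‿+-comm; -0#≈0#; -1*x≈-x; x∙y⁻¹≈ε⇒x≈y; x≈y⇒x∙y⁻¹≈ε)
  open import Algebra.Properties.CommutativeSemigroup +-commutativeSemigroup
    using () renaming (interchange to +-interchange)
  open import Algebra.Properties.CommutativeSemigroup *-commutativeSemigroup
    using () renaming (interchange to *-interchange)
  open import Algebra.Properties.Semiring.Mult.TCOptimised semiring
    using (_×_; 1+×; ×-homo-+; ×1-homo-*)
  open import Relation.Binary.Reasoning.Setoid setoid

  ⟦_⟧ : ℤ → Carrier
  ⟦ + n ⟧      = n × 1#
  ⟦ -[1+ n ] ⟧ = - (suc n × 1#)

  ⊖-homo : ∀ m n → ⟦ m ⊖ n ⟧ ≈ m × 1# - n × 1#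
  ⊖-homo m       zero    = sym (trans (+-congˡ -0#≈0#) (+-identityʳ _))
  ⊖-homo zero    (suc n) = sym (+-identityˡ _)
  ⊖-homo (suc m) (suc n) = begin
    ⟦ suc m ⊖ suc n ⟧                     ≡⟨ ≡.cong ⟦_⟧ (ℤP.[1+m]⊖[1+n]≡m⊖n m n) ⟩
    ⟦ m ⊖ n ⟧                             ≈⟨ ⊖-homo m n ⟩
    m × 1# - n × 1#                       ≈⟨ +-identityˡ _ ⟨
    0# + (m × 1# - n × 1#)                ≈⟨ +-congʳ (-‿inverseʳ 1#) ⟨
    (1# - 1#) + (m × 1# - n × 1#)         ≈⟨ +-interchange _ _ _ _ ⟩
    (1# + m × 1#) + (- 1# + - (n × 1#))   ≈⟨ +-cong (1+× m 1#) (sym (-‿+-comm _ _)) ⟨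
    suc m × 1# - (1# + n × 1#)            ≈⟨ +-congˡ (-‿cong (1+× n 1#)) ⟨
    suc m × 1# - suc n × 1#               ∎

  +-homo : ∀ i j → ⟦ i ℤ.+ j ⟧ ≈ ⟦ i ⟧ + ⟦ j ⟧
  +-homo (+ m)      (+ n)      = ×-homo-+ 1# m n
  +-homo (+ m)      -[1+ n ]   = ⊖-homo m (suc n)
  +-homo -[1+ m ]   (+ n)      = trans (⊖-homo n (suc m)) (+-comm _ _)
  +-homo -[1+ m ]   -[1+ n ]   = begin
    - (suc (suc (m N.+ n)) × 1#)       ≡⟨ ≡.cong (λ k → - (suc k × 1#)) (NP.+-suc m n) ⟨
    - ((suc m N.+ suc n) × 1#)         ≈⟨ -‿cong (×-homo-+ 1# (suc m) (suc n)) ⟩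
    - (suc m × 1# + suc n × 1#)        ≈⟨ -‿+-comm _ _ ⟨
    - (suc m × 1#) + - (suc n × 1#)    ∎

  -‿homo : ∀ i → ⟦ ℤ.- i ⟧ ≈ - ⟦ i ⟧
  -‿homo -[1+ n ]    = sym (-‿involutive _)
  -‿homo (+ zero)    = sym -0#≈0#
  -‿homo (+ suc n)   = refl

  ⟦_⟧ₛ : Sign → Carrier
  ⟦ Sign.+ ⟧ₛ = 1#
  ⟦ Sign.- ⟧ₛ = - 1#

  ◃-homo : ∀ s n → ⟦ s ℤ.◃ n ⟧ ≈ ⟦ s ⟧ₛ * n × 1#
  ◃-homo s       zero    = sym (zeroʳ _)
  ◃-homo Sign.+ (suc n) = sym (*-identityˡ _)
  ◃-homo Sign.- (suc n) = sym (-1*x≈-x _)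

  ⟦⟧ₛ-homo-* : ∀ s t → ⟦ s Sign.* t ⟧ₛ ≈ ⟦ s ⟧ₛ * ⟦ t ⟧ₛ
  ⟦⟧ₛ-homo-* Sign.+ t      = sym (*-identityˡ _)
  ⟦⟧ₛ-homo-* Sign.- Sign.+ = sym (*-identityʳ _)
  ⟦⟧ₛ-homo-* Sign.- Sign.- = sym (trans (-1*x≈-x _) (-‿involutive _))

  *-homo : ∀ i j → ⟦ i ℤ.* j ⟧ ≈ ⟦ i ⟧ * ⟦ j ⟧
  *-homo i j = begin
    ⟦ (ℤ.sign i Sign.* ℤ.sign j) ℤ.◃ ℤ.∣ i ∣ N.* ℤ.∣ j ∣ ⟧
      ≈⟨ ◃-homo (ℤ.sign i Sign.* ℤ.sign j) (ℤ.∣ i ∣ N.* ℤ.∣ j ∣) ⟩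
    ⟦ ℤ.sign i Sign.* ℤ.sign j ⟧ₛ * (ℤ.∣ i ∣ N.* ℤ.∣ j ∣) × 1#
      ≈⟨ *-cong (⟦⟧ₛ-homo-* (ℤ.sign i) (ℤ.sign j)) (×1-homo-* ℤ.∣ i ∣ ℤ.∣ j ∣) ⟩
    (⟦ ℤ.sign i ⟧ₛ * ⟦ ℤ.sign j ⟧ₛ) * (ℤ.∣ i ∣ × 1# * ℤ.∣ j ∣ × 1#)
      ≈⟨ *-interchange _ _ _ _ ⟩
    (⟦ ℤ.sign i ⟧ₛ * ℤ.∣ i ∣ × 1#) * (⟦ ℤ.sign j ⟧ₛ * ℤ.∣ j ∣ × 1#)
      ≈⟨ *-cong (◃-homo (ℤ.sign i) ℤ.∣ i ∣) (◃-homo (ℤ.sign j) ℤ.∣ j ∣) ⟨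
    ⟦ ℤ.sign i ℤ.◃ ℤ.∣ i ∣ ⟧ * ⟦ ℤ.sign j ℤ.◃ ℤ.∣ j ∣ ⟧
      ≡⟨ ≡.cong₂ (λ i j → ⟦ i ⟧ * ⟦ j ⟧) (ℤP.signᵢ◃∣i∣≡i i) (ℤP.signᵢ◃∣i∣≡i j) ⟩
    ⟦ i ⟧ * ⟦ j ⟧ ∎

  fromℤ : ℤ.+-*-rawRing -Raw-AlmostCommutative⟶ fromCommutativeRing R
  fromℤ = record
    { ⟦_⟧ = ⟦_⟧ ; +-homo = +-homo ; *-homo = *-homo ; -‿homo = -‿homo
    ; 0-homo = refl ; 1-homo = refl }

  ≟-homo : ∀ i j → Maybe (⟦ i ⟧ ≈ ⟦ j ⟧)
  ≟-homo i j with i ℤ.≟ j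
  ... | yes ≡.refl = just refl
  ... | no _       = nothing

  open Algebra.Solver.Ring ℤ.+-*-rawRing (fromCommutativeRing R) fromℤ ≟-homo public
    using (Polynomial; solve; _:=_; _:+_; _:*_; _:-_; :-_; con)

  :0 :1 : ∀ {n} → Polynomial n
  :0 = con (+ 0)
  :1 = con (+ 1)

  -- How hypotheses are fed to the solver: it proves x - y ≈ Σ kᵢ (uᵢ - vᵢ) as a polynomial identity,
  -- and the hypotheses uᵢ ≈ vᵢ make the right side vanish.
  private
    vanishes : ∀ k {u v} → u ≈ v → k * (u - v) ≈ 0#
    vanishes k u≈v = trans (*-congˡ (x≈y⇒x∙y⁻¹≈ε u≈v)) (zeroʳ k)

    0+0≈0 : ∀ {x y} → x ≈ 0# → y ≈ 0# → x + y ≈ 0#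
    0+0≈0 x≈0 y≈0 = trans (+-cong x≈0 y≈0) (+-identityʳ 0#)

  combination₁ : ∀ {x y k u v} → x - y ≈ k * (u - v) → u ≈ v → x ≈ y
  combination₁ {x} {y} {k} eq e₁ = x∙y⁻¹≈ε⇒x≈y x y (trans eq (vanishes k e₁))

  combination₂ : ∀ {x y k₁ u₁ v₁ k₂ u₂ v₂} →
    x - y ≈ k₁ * (u₁ - v₁) + k₂ * (u₂ - v₂) → u₁ ≈ v₁ → u₂ ≈ v₂ → x ≈ y
  combination₂ {x} {y} {k₁} {k₂ = k₂} eq e₁ e₂ =
    x∙y⁻¹≈ε⇒x≈y x y (trans eq (0+0≈0 (vanishes k₁ e₁) (vanishes k₂ e₂)))

  combination₃ : ∀ {x y k₁ u₁ v₁ k₂ u₂ v₂ k₃ u₃ v₃} →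
    x - y ≈ k₁ * (u₁ - v₁) + k₂ * (u₂ - v₂) + k₃ * (u₃ - v₃) →
    u₁ ≈ v₁ → u₂ ≈ v₂ → u₃ ≈ v₃ → x ≈ y
  combination₃ {x} {y} {k₁} {k₂ = k₂} {k₃ = k₃} eq e₁ e₂ e₃ =
    x∙y⁻¹≈ε⇒x≈y x y (trans eq (0+0≈0 (0+0≈0 (vanishes k₁ e₁) (vanishes k₂ e₂)) (vanishes k₃ e₃)))

module QCalcProperties {c ℓ : Level} (R : CommutativeRing c ℓ) where
  open CommutativeRing R
  open QCalc R
  open IntegerCoefficients R
  open import Algebra.Properties.Ring ring using (+-cancelʳ)
  open import Relation.Binary.Reasoning.Setoid setoid

  pow-cong : ∀ {x y} n → x ≈ y → pow x n ≈ pow y n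
  pow-cong zero    x≈y = refl
  pow-cong (suc n) x≈y = *-cong x≈y (pow-cong n x≈y)

  pow-+ : ∀ x m n → pow x (m N.+ n) ≈ pow x m * pow x n
  pow-+ x zero    n = sym (*-identityˡ _)
  pow-+ x (suc m) n = trans (*-congˡ (pow-+ x m n)) (sym (*-assoc _ _ _))

  pow-distrib-* : ∀ x y n → pow (x * y) n ≈ pow x n * pow y n
  pow-distrib-* x y zero    = sym (*-identityˡ 1#)
  pow-distrib-* x y (suc n) = begin
    x * y * pow (x * y) n          ≈⟨ *-congˡ (pow-distrib-* x y n) ⟩
    x * y * (pow x n * pow y n)    ≈⟨ solve 4 (λ x y p r → x :* y :* (p :* r) := x :* p :* (y :* r)) refl x y _ _ ⟩
    x * pow x n * (y * pow y n)    ∎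

  pow-inverse : ∀ {x y} → x * y ≈ 1# → ∀ n → pow x n * pow y n ≈ 1#
  pow-inverse xy≈1 zero = *-identityˡ 1#
  pow-inverse {x} {y} xy≈1 (suc n) = begin
    x * pow x n * (y * pow y n)    ≈⟨ solve 4 (λ x y p r → x :* p :* (y :* r) := x :* y :* (p :* r)) refl x y _ _ ⟩
    x * y * (pow x n * pow y n)    ≈⟨ *-cong xy≈1 (pow-inverse xy≈1 n) ⟩
    1# * 1#                        ≈⟨ *-identityˡ 1# ⟩
    1#                             ∎

  qint-suc : ∀ x n → qint x (suc n) ≈ 1# + x * qint x n
  qint-suc x zero    = solve 1 (λ x → :0 :+ :1 := :1 :+ x :* :0) refl x
  qint-suc x (suc n) = begin
    qint x (suc n) + x * pow x n         ≈⟨ +-congʳ (qint-suc x n) ⟩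
    1# + x * qint x n + x * pow x n      ≈⟨ solve 3 (λ x y p → :1 :+ x :* y :+ x :* p := :1 :+ x :* (y :+ p)) refl x _ _ ⟩
    1# + x * (qint x n + pow x n)        ∎

  qint-+ : ∀ x m n → qint x (m N.+ n) ≈ qint x m + pow x m * qint x n
  qint-+ x m zero    = begin
    qint x (m N.+ 0)                  ≡⟨ ≡.cong (qint x) (NP.+-identityʳ m) ⟩
    qint x m                          ≈⟨ solve 2 (λ y p → y := y :+ p :* :0) refl _ _ ⟩
    qint x m + pow x m * 0#           ∎
  qint-+ x m (suc n) = begin
    qint x (m N.+ suc n)                                 ≡⟨ ≡.cong (qint x) (NP.+-suc m n) ⟩
    qint x (m N.+ n) + pow x (m N.+ n)                   ≈⟨ +-cong (qint-+ x m n) (pow-+ x m n) ⟩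
    qint x m + pow x m * qint x n + pow x m * pow x n    ≈⟨ solve 4 (λ y p z r → y :+ p :* z :+ p :* r := y :+ p :* (z :+ r)) refl _ _ _ _ ⟩
    qint x m + pow x m * (qint x n + pow x n)            ∎

  qint-* : ∀ x m n → qint x (m N.* n) ≈ qint x m * qint (pow x m) n
  qint-* x m zero    = begin
    qint x (m N.* 0)                  ≡⟨ ≡.cong (qint x) (NP.*-zeroʳ m) ⟩
    0#                                ≈⟨ zeroʳ _ ⟨
    qint x m * 0#                     ∎
  qint-* x m (suc n) = begin
    qint x (m N.* suc n)                                 ≡⟨ ≡.cong (qint x) (NP.*-suc m n) ⟩
    qint x (m N.+ m N.* n)                               ≈⟨ qint-+ x m (m N.* n) ⟩
    qint x m + pow x m * qint x (m N.* n)                ≈⟨ +-congˡ (*-congˡ (qint-* x m n)) ⟩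
    qint x m + pow x m * (qint x m * qint (pow x m) n)   ≈⟨ solve 3 (λ y p z → y :+ p :* (y :* z) := y :* (:1 :+ p :* z)) refl _ _ _ ⟩
    qint x m * (1# + pow x m * qint (pow x m) n)         ≈⟨ *-congˡ (qint-suc (pow x m) n) ⟨
    qint x m * qint (pow x m) (suc n)                    ∎

  geometric-sum : ∀ x n → (1# - x) * qint x n ≈ 1# - pow x n
  geometric-sum x zero    = solve 1 (λ x → (:1 :- x) :* :0 := :1 :- :1) refl x
  geometric-sum x (suc n) = begin
    (1# - x) * (qint x n + pow x n)             ≈⟨ distribˡ _ _ _ ⟩
    (1# - x) * qint x n + (1# - x) * pow x n    ≈⟨ +-congʳ (geometric-sum x n) ⟩
    1# - pow x n + (1# - x) * pow x n           ≈⟨ solve 2 (λ x p → :1 :- p :+ (:1 :- x) :* p := :1 :- x :* p) refl x _ ⟩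
    1# - x * pow x n                            ∎

  wtAux-suc : ∀ x y k j → j N.≤ k → wtAux x y (suc k) j ≈ x * wtAux x y k j
  wtAux-suc x y k zero j≤k = sym (zeroʳ x)
  wtAux-suc x y (suc k) (suc j) (N.s≤s j≤k) = begin
    wtAux x y (suc (suc k)) j + pow x (suc k ∸ j) * pow y j
      ≈⟨ +-congˡ (*-congʳ (reflexive (≡.cong (pow x) (NP.+-∸-assoc 1 j≤k)))) ⟩
    wtAux x y (suc (suc k)) j + x * pow x (k ∸ j) * pow y j
      ≈⟨ +-congʳ (wtAux-suc x y (suc k) j (NP.m≤n⇒m≤1+n j≤k)) ⟩
    x * wtAux x y (suc k) j + x * pow x (k ∸ j) * pow y j
      ≈⟨ solve 4 (λ x w p r → x :* w :+ x :* p :* r := x :* (w :+ p :* r)) refl x _ _ _ ⟩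
    x * (wtAux x y (suc k) j + pow x (k ∸ j) * pow y j) ∎

  wt-suc : ∀ x y k → wt x y (suc k) ≈ x * wt x y k + pow y k
  wt-suc x y k = begin
    wtAux x y (suc k) k + pow x (k ∸ k) * pow y k   ≈⟨ +-cong (wtAux-suc x y k k NP.≤-refl) (*-congʳ (reflexive (≡.cong (pow x) (NP.n∸n≡0 k)))) ⟩
    x * wt x y k + 1# * pow y k                     ≈⟨ +-congˡ (*-identityˡ _) ⟩
    x * wt x y k + pow y k                          ∎

  wt-as-qint : ∀ {q qi} → q * qi ≈ 1# → ∀ a → pow q (a ∸ 1) * wt q qi a ≈ qint (q * q) a
  wt-as-qint q*qi≈1 zero          = zeroʳ 1#
  wt-as-qint q*qi≈1 (suc zero)    = solve 0 (:1 :* (:0 :+ :1 :* :1) := :0 :+ :1) refl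
  wt-as-qint {q} {qi} q*qi≈1 (suc (suc a)) = begin
    q * pow q a * wt q qi (suc (suc a))
      ≈⟨ *-congˡ (wt-suc q qi (suc a)) ⟩
    q * pow q a * (q * wt q qi (suc a) + pow qi (suc a))
      ≈⟨ solve 4 (λ q p w r → q :* p :* (q :* w :+ r) := q :* q :* (p :* w) :+ q :* p :* r) refl q _ _ _ ⟩
    q * q * (pow q a * wt q qi (suc a)) + pow q (suc a) * pow qi (suc a)
      ≈⟨ +-cong (*-congˡ (wt-as-qint q*qi≈1 (suc a))) (pow-inverse q*qi≈1 (suc a)) ⟩
    q * q * qint (q * q) (suc a) + 1#
      ≈⟨ trans (+-comm _ _) (sym (qint-suc (q * q) (suc a))) ⟩
    qint (q * q) (suc (suc a)) ∎

  sum1-cong : ∀ {f g : ℕ → Carrier} n → (∀ k → k N.≤ n → f k ≈ g k) → sum1 f n ≈ sum1 g n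
  sum1-cong zero    f≈g = refl
  sum1-cong (suc n) f≈g = +-cong (sum1-cong n (λ k k≤n → f≈g k (NP.m≤n⇒m≤1+n k≤n))) (f≈g (suc n) NP.≤-refl)

  sum1-+ : ∀ (f g : ℕ → Carrier) n → sum1 (λ k → f k + g k) n ≈ sum1 f n + sum1 g n
  sum1-+ f g zero    = sym (+-identityʳ 0#)
  sum1-+ f g (suc n) = trans (+-congʳ (sum1-+ f g n))
    (solve 4 (λ s t x y → s :+ t :+ (x :+ y) := s :+ x :+ (t :+ y)) refl _ _ _ _)

  sum1-*ˡ : ∀ x (f : ℕ → Carrier) n → sum1 (λ k → x * f k) n ≈ x * sum1 f n
  sum1-*ˡ x f zero    = sym (zeroʳ x)
  sum1-*ˡ x f (suc n) = trans (+-congʳ (sum1-*ˡ x f n)) (sym (distribˡ x _ _))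

  sum1-pred : ∀ (f : ℕ → Carrier) n → f n ≈ 0# → sum1 f (n ∸ 1) ≈ sum1 f n
  sum1-pred f zero    fn≈0 = refl
  sum1-pred f (suc n) fn≈0 = sym (trans (+-congˡ fn≈0) (+-identityʳ _))

  Recurrence : Carrier → Carrier → (ℕ → Carrier) → (ℕ → Carrier) → Set ℓ
  Recurrence σ π e X = ∀ a → X (2 N.+ a) + π * X a ≈ σ * X (1 N.+ a) + e a

  recurrence-unique : ∀ {σ π e f X Y} → Recurrence σ π e X → Recurrence σ π f Y →
    (∀ a → e a ≈ f a) → X 0 ≈ Y 0 → X 1 ≈ Y 1 → ∀ a → X a ≈ Y a
  recurrence-unique {σ} {π} {e} {f} {X} {Y} rec-X rec-Y e≈f X₀≈Y₀ X₁≈Y₁ = agree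
    where
    agree : ∀ a → X a ≈ Y a
    agree zero          = X₀≈Y₀
    agree (suc zero)    = X₁≈Y₁
    agree (suc (suc a)) = +-cancelʳ (π * X a) (X (2 N.+ a)) (Y (2 N.+ a)) (begin
      X (2 N.+ a) + π * X a      ≈⟨ rec-X a ⟩
      σ * X (1 N.+ a) + e a      ≈⟨ +-cong (*-congˡ (agree (suc a))) (e≈f a) ⟩
      σ * Y (1 N.+ a) + f a      ≈⟨ rec-Y a ⟨
      Y (2 N.+ a) + π * Y a      ≈⟨ +-congˡ (*-congˡ (agree a)) ⟨
      Y (2 N.+ a) + π * X a      ∎)

  recurrence-cong : ∀ {σ π e X Y} → (∀ a → X a ≈ Y a) → Recurrence σ π e X → Recurrence σ π e Y
  recurrence-cong X≈Y rec a =
    trans (+-cong (sym (X≈Y (2 N.+ a))) (*-congˡ (sym (X≈Y a))))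
          (trans (rec a) (+-congʳ (*-congˡ (X≈Y (1 N.+ a)))))

  recurrence-coeff-cong : ∀ {σ σ′ π π′ e X} → σ ≈ σ′ → π ≈ π′ → Recurrence σ π e X → Recurrence σ′ π′ e X
  recurrence-coeff-cong {σ} {σ′} {π} {π′} {e} {X} σ≈σ′ π≈π′ rec a = combination₃
    (solve 8 (λ σ σ′ π π′ x₂ x₁ x₀ ε →
       x₂ :+ π′ :* x₀ :- (σ′ :* x₁ :+ ε)
         := :1 :* (x₂ :+ π :* x₀ :- (σ :* x₁ :+ ε)) :+ x₁ :* (σ :- σ′) :+ (:- x₀) :* (π :- π′))
       refl σ σ′ π π′ (X (2 N.+ a)) (X (1 N.+ a)) (X a) (e a))
    (rec a) σ≈σ′ π≈π′

  recurrence-shift : ∀ {σ π e X} σ′ → Recurrence σ π e X →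
    Recurrence σ′ π (λ a → e a + (σ - σ′) * X (1 N.+ a)) X
  recurrence-shift {σ} {π} {e} {X} σ′ rec a = combination₁
    (solve 7 (λ σ σ′ π x₂ x₁ x₀ ε →
       x₂ :+ π :* x₀ :- (σ′ :* x₁ :+ (ε :+ (σ :- σ′) :* x₁))
         := :1 :* (x₂ :+ π :* x₀ :- (σ :* x₁ :+ ε)))
       refl σ σ′ π (X (2 N.+ a)) (X (1 N.+ a)) (X a) (e a))
    (rec a)

  recurrence-*ˡ : ∀ {σ π e X} κ → Recurrence σ π e X →
    Recurrence σ π (λ a → κ * e a) (λ a → κ * X a)
  recurrence-*ˡ {σ} {π} {e} {X} κ rec a = combination₁
    (solve 7 (λ κ σ π x₂ x₁ x₀ ε →
       κ :* x₂ :+ π :* (κ :* x₀) :- (σ :* (κ :* x₁) :+ κ :* ε)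
         := κ :* (x₂ :+ π :* x₀ :- (σ :* x₁ :+ ε)))
       refl κ σ π (X (2 N.+ a)) (X (1 N.+ a)) (X a) (e a))
    (rec a)

  recurrence-geometric : ∀ {σ π e X} t → Recurrence σ π e X →
    Recurrence (t * σ) (t * t * π) (λ a → pow t (2 N.+ a) * e a) (λ a → pow t a * X a)
  recurrence-geometric {σ} {π} {e} {X} t rec a = combination₁
    (solve 8 (λ t p σ π x₂ x₁ x₀ ε →
       t :* (t :* p) :* x₂ :+ t :* t :* π :* (p :* x₀) :- (t :* σ :* (t :* p :* x₁) :+ t :* (t :* p) :* ε)
         := t :* (t :* p) :* (x₂ :+ π :* x₀ :- (σ :* x₁ :+ ε)))
       refl t (pow t a) σ π (X (2 N.+ a)) (X (1 N.+ a)) (X a) (e a))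
    (rec a)

  recurrence-+ : ∀ {σ π e f X Y} → Recurrence σ π e X → Recurrence σ π f Y →
    Recurrence σ π (λ a → e a + f a) (λ a → X a + Y a)
  recurrence-+ {σ} {π} {e} {f} {X} {Y} rec-X rec-Y a = combination₂
    (solve 10 (λ σ π x₂ x₁ x₀ y₂ y₁ y₀ ε φ →
       x₂ :+ y₂ :+ π :* (x₀ :+ y₀) :- (σ :* (x₁ :+ y₁) :+ (ε :+ φ))
         := :1 :* (x₂ :+ π :* x₀ :- (σ :* x₁ :+ ε)) :+ :1 :* (y₂ :+ π :* y₀ :- (σ :* y₁ :+ φ)))
       refl σ π (X (2 N.+ a)) (X (1 N.+ a)) (X a) (Y (2 N.+ a)) (Y (1 N.+ a)) (Y a) (e a) (f a))
    (rec-X a) (rec-Y a)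

  recurrence-sub : ∀ {σ π e f X Y} → Recurrence σ π e X → Recurrence σ π f Y →
    Recurrence σ π (λ a → e a - f a) (λ a → X a - Y a)
  recurrence-sub {σ} {π} {e} {f} {X} {Y} rec-X rec-Y a = combination₂
    (solve 10 (λ σ π x₂ x₁ x₀ y₂ y₁ y₀ ε φ →
       x₂ :- y₂ :+ π :* (x₀ :- y₀) :- (σ :* (x₁ :- y₁) :+ (ε :- φ))
         := :1 :* (x₂ :+ π :* x₀ :- (σ :* x₁ :+ ε)) :+ (:- :1) :* (y₂ :+ π :* y₀ :- (σ :* y₁ :+ φ)))
       refl σ π (X (2 N.+ a)) (X (1 N.+ a)) (X a) (Y (2 N.+ a)) (Y (1 N.+ a)) (Y a) (e a) (f a))
    (rec-X a) (rec-Y a)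

  qint-recurrence : ∀ x → Recurrence (1# + x) x (λ _ → 0#) (qint x)
  qint-recurrence x a =
    solve 3 (λ x y p → y :+ p :+ x :* p :+ x :* y := (:1 :+ x) :* (y :+ p) :+ :0) refl x (qint x a) (pow x a)

  -- The factors are affine in r^a and s^a, which the characteristic polynomial (t - r)(t - s) kills;
  -- what survives is the constant and the (r s)^a component.
  qint-product-recurrence : ∀ r s v₀ m →
    Recurrence (r + s) (r * s) (λ a → (1# - s) * v₀ + m + r * s * m * pow (r * s) a)
                               (λ a → qint r a * (v₀ + m * qint s a))
  qint-product-recurrence r s v₀ m a = combination₃
    (solve 9 (λ r s v₀ m u w ρ ς P →
       (u :+ ρ :+ r :* ρ) :* (v₀ :+ m :* (w :+ ς :+ s :* ς)) :+ r :* s :* (u :* (v₀ :+ m :* w))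
         :- ((r :+ s) :* ((u :+ ρ) :* (v₀ :+ m :* (w :+ ς))) :+ ((:1 :- s) :* v₀ :+ m :+ r :* s :* m :* P))
         := ((:1 :- s) :* (v₀ :+ m :* w) :+ m :* ς) :* ((:1 :- r) :* u :- (:1 :- ρ))
            :+ m :* ((:1 :- s) :* w :- (:1 :- ς))
            :+ (:- (r :* s :* m)) :* (P :- ρ :* ς))
       refl r s v₀ m (qint r a) (qint s a) (pow r a) (pow s a) (pow (r * s) a))
    (geometric-sum r a) (geometric-sum s a) (pow-distrib-* r s a)

  convolution-recurrence : ∀ (f : ℕ → Carrier) x →
    Recurrence (1# + x) x (λ a → f (suc a)) (λ a → sum1 (λ k → f k * qint x (a ∸ k)) a)
  convolution-recurrence f x a = combination₃
    (solve 8 (λ x s₂ s₁ s₀ φ₁ φ₂ y₁ y₀ →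
       s₂ :+ φ₁ :* y₁ :+ φ₂ :* y₀ :+ x :* s₀ :- ((:1 :+ x) :* (s₁ :+ φ₁ :* y₀) :+ φ₁)
         := :1 :* (s₂ :+ x :* s₀ :- (:1 :+ x) :* s₁) :+ φ₁ :* (y₁ :- :1) :+ (φ₂ :- (:1 :+ x) :* φ₁) :* (y₀ :- :0))
       refl x (sum-at (2 N.+ a)) (sum-at (1 N.+ a)) (sum-at a) (f (1 N.+ a)) (f (2 N.+ a))
       (qint x (suc a ∸ a)) (qint x (a ∸ a)))
    sums-recurrence
    (trans (reflexive (≡.cong (qint x) (NP.m+n∸n≡m 1 a))) (+-identityˡ 1#))
    (reflexive (≡.cong (qint x) (NP.n∸n≡0 a)))
    where
    sum-at : ℕ → Carrier
    sum-at j = sum1 (λ k → f k * qint x (j ∸ k)) a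

    termwise : ∀ k → k N.≤ a →
      f k * qint x (2 N.+ a ∸ k) + x * (f k * qint x (a ∸ k)) ≈ (1# + x) * (f k * qint x (1 N.+ a ∸ k))
    termwise k k≤a = ≡.subst₂
      (λ m n → f k * qint x m + x * (f k * qint x (a ∸ k)) ≈ (1# + x) * (f k * qint x n))
      (≡.sym (NP.+-∸-assoc 2 k≤a)) (≡.sym (NP.+-∸-assoc 1 k≤a))
      (trans (recurrence-*ˡ (f k) (qint-recurrence x) (a ∸ k)) (trans (+-congˡ (zeroʳ _)) (+-identityʳ _)))

    sums-recurrence : sum-at (2 N.+ a) + x * sum-at a ≈ (1# + x) * sum-at (1 N.+ a)
    sums-recurrence = begin
      sum-at (2 N.+ a) + x * sum-at a
        ≈⟨ +-congˡ (sum1-*ˡ x (λ k → f k * qint x (a ∸ k)) a) ⟨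
      sum-at (2 N.+ a) + sum1 (λ k → x * (f k * qint x (a ∸ k))) a
        ≈⟨ sum1-+ (λ k → f k * qint x (2 N.+ a ∸ k)) (λ k → x * (f k * qint x (a ∸ k))) a ⟨
      sum1 (λ k → f k * qint x (2 N.+ a ∸ k) + x * (f k * qint x (a ∸ k))) a
        ≈⟨ sum1-cong a termwise ⟩
      sum1 (λ k → (1# + x) * (f k * qint x (1 N.+ a ∸ k))) a
        ≈⟨ sum1-*ˡ (1# + x) (λ k → f k * qint x (1 N.+ a ∸ k)) a ⟩
      (1# + x) * sum-at (1 N.+ a) ∎

module Theorem {c ℓ : Level} (R : CommutativeRing c ℓ) where
  open CommutativeRing R
  open QCalc R
  open IntegerCoefficients R
  open QCalcProperties R
  open import Relation.Binary.Reasoning.Setoid setoid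

  module _ (q qi : Carrier) (q*qi≈1 : q * qi ≈ 1#) (d-1 z : ℕ) where
    d : ℕ
    d = suc d-1

    Q K : Carrier
    Q = pow q d
    K = (1# - q) * (1# - qi)

    ζ ζ′ : ℕ → Carrier
    ζ  a = qint q (z N.+ a)
    ζ′ a = qint q (z N.+ d N.* a)

    L A B S T : ℕ → Carrier
    L a = qint (pow q (suc d)) a * qint q d * ζ a
    A a = pow q a * qint Q a * qint q d-1 * qint q z
    B a = pow q (a ∸ 1) * wt q qi a * ζ′ a
    S a = sum1 (λ k → wt q qi k * qint Q (a ∸ k) * qint q d-1 * ζ′ k) (a ∸ 1)
    T a = pow q a * K * S a

    weight : ℕ → Carrier
    weight k = wt q qi k * qint q d-1 * ζ′ k

    σ π : Carrier
    σ = q * (1# + Q)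
    π = q * q * Q

    eL eA eB eT : ℕ → Carrier
    eL a = qint q d * ((1# - q) * qint q z + pow q z + q * Q * q * pow q z * pow (q * Q * q) a)
    eA a = qint q d-1 * qint q z * (pow q (2 N.+ a) * 0#)
    eB a = (1# - Q) * qint q z + pow q z * qint q d + q * q * Q * (pow q z * qint q d) * pow (q * q * Q) a
           + (q * q + Q - σ) * B (1 N.+ a)
    eT a = pow q (2 N.+ a) * (K * weight (1 N.+ a))

    ζ′-affine : ∀ a → ζ′ a ≈ qint q z + pow q z * qint q d * qint Q a
    ζ′-affine a = begin
      qint q (z N.+ d N.* a)                          ≈⟨ qint-+ q z (d N.* a) ⟩
      qint q z + pow q z * qint q (d N.* a)           ≈⟨ +-congˡ (*-congˡ (qint-* q d a)) ⟩
      qint q z + pow q z * (qint q d * qint Q a)      ≈⟨ +-congˡ (*-assoc _ _ _) ⟨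
      qint q z + pow q z * qint q d * qint Q a        ∎

    S≈convolution : ∀ a → S a ≈ sum1 (λ k → weight k * qint Q (a ∸ k)) a
    S≈convolution a = trans (sum1-pred _ a last-term≈0) (sum1-cong a (λ k _ → rearrange k))
      where
      last-term≈0 : wt q qi a * qint Q (a ∸ a) * qint q d-1 * ζ′ a ≈ 0#
      last-term≈0 = trans (reflexive (≡.cong (λ j → wt q qi a * qint Q j * qint q d-1 * ζ′ a) (NP.n∸n≡0 a)))
                          (solve 3 (λ w c ζ → w :* :0 :* c :* ζ := :0) refl _ _ _)

      rearrange : ∀ k → wt q qi k * qint Q (a ∸ k) * qint q d-1 * ζ′ k ≈ weight k * qint Q (a ∸ k)
      rearrange k = solve 4 (λ w y c ζ → w :* y :* c :* ζ := w :* c :* ζ :* y) refl _ _ _ _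

    L-recurrence : Recurrence σ π eL L
    L-recurrence =
      recurrence-coeff-cong (solve 2 (λ q Q → q :* Q :+ q := q :* (:1 :+ Q)) refl q Q)
                            (solve 2 (λ q Q → q :* Q :* q := q :* q :* Q) refl q Q)
        (recurrence-cong factors-of-L
          (recurrence-*ˡ (qint q d) (qint-product-recurrence (q * Q) q (qint q z) (pow q z))))
      where
      factors-of-L : ∀ a → qint q d * (qint (q * Q) a * (qint q z + pow q z * qint q a)) ≈ L a
      factors-of-L a = trans (*-congˡ (*-congˡ (sym (qint-+ q z a))))
                             (solve 3 (λ δ u v → δ :* (u :* v) := u :* δ :* v) refl _ _ _)

    A-recurrence : Recurrence σ π eA A
    A-recurrence =
      recurrence-cong (λ a → solve 4 (λ c y p u → c :* y :* (p :* u) := p :* u :* c :* y) refl _ _ _ _)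
        (recurrence-*ˡ (qint q d-1 * qint q z) (recurrence-geometric q (qint-recurrence Q)))

    B-recurrence : Recurrence σ π eB B
    B-recurrence =
      recurrence-shift σ (recurrence-cong (λ a → sym (*-cong (wt-as-qint q*qi≈1 a) (ζ′-affine a)))
        (qint-product-recurrence (q * q) Q (qint q z) (pow q z * qint q d)))

    T-recurrence : Recurrence σ π eT T
    T-recurrence =
      recurrence-cong (λ a → sym (trans (*-assoc _ _ _) (*-congˡ (*-congˡ (S≈convolution a)))))
        (recurrence-geometric q (recurrence-*ˡ K (convolution-recurrence weight Q)))

    σ-gap : q * q + Q - σ ≈ q * q * K * qint q d-1
    σ-gap = combination₂
      (solve 4 (λ q qi c E →
         q :* q :+ q :* E :- q :* (:1 :+ q :* E) :- q :* q :* ((:1 :- q) :* (:1 :- qi)) :* c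
           := q :* (:1 :- E) :* (q :* qi :- :1) :+ (:- (q :* (q :- q :* qi))) :* ((:1 :- q) :* c :- (:1 :- E)))
         refl q qi (qint q d-1) (pow q d-1))
      q*qi≈1 (geometric-sum q d-1)

    sources-agree : ∀ a → eL a ≈ (eA a + eB a) - eT a
    sources-agree a = combination₃
      (solve 12 (λ q Q K c y m δ P₁ P₂ p w ζ →
         δ :* ((:1 :- q) :* y :+ m :+ q :* Q :* q :* m :* P₁)
           :- ((c :* y :* (q :* (q :* p) :* :0)
                :+ ((:1 :- Q) :* y :+ m :* δ :+ q :* q :* Q :* (m :* δ) :* P₂
                    :+ (q :* q :+ Q :- q :* (:1 :+ Q)) :* (p :* w :* ζ)))
               :- q :* (q :* p) :* (K :* (w :* c :* ζ)))
           := y :* ((:1 :- q) :* δ :- (:1 :- Q))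
              :+ (q :* q :* Q :* m :* δ) :* (P₁ :- P₂)
              :+ (:- (p :* w :* ζ)) :* ((q :* q :+ Q :- q :* (:1 :+ Q)) :- q :* q :* K :* c))
         refl q Q K (qint q d-1) (qint q z) (pow q z) (qint q d)
         (pow (q * Q * q) a) (pow (q * q * Q) a) (pow q a) (wt q qi (1 N.+ a)) (ζ′ (1 N.+ a)))
      (geometric-sum q d)
      (pow-cong a (solve 2 (λ q Q → q :* Q :* q := q :* q :* Q) refl q Q))
      σ-gap

    agree-at-0 : L 0 ≈ (A 0 + B 0) - T 0
    agree-at-0 = solve 6 (λ δ ζ c y ζ′ K → :0 :* δ :* ζ := :1 :* :0 :* c :* y :+ :1 :* :0 :* ζ′ :- :1 :* K :* :0)
      refl (qint q d) (ζ 0) (qint q d-1) (qint q z) (ζ′ 0) K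

    agree-at-1 : L 1 ≈ (A 1 + B 1) - T 1
    agree-at-1 = combination₃
      (solve 8 (λ q δ ζ c y ζ′ K m →
         (:0 :+ :1) :* δ :* ζ
           :- (q :* :1 :* (:0 :+ :1) :* c :* y :+ :1 :* (:0 :+ :1 :* :1) :* ζ′ :- q :* :1 :* K :* :0)
           := δ :* (ζ :- (y :+ m :* (:0 :+ :1))) :+ (:- :1) :* (ζ′ :- (y :+ m :* δ :* (:0 :+ :1)))
              :+ y :* (δ :- (:1 :+ q :* c)))
         refl q (qint q d) (ζ 1) (qint q d-1) (qint q z) (ζ′ 1) K (pow q z))
      (qint-+ q z 1) (ζ′-affine 1) (qint-suc q d-1)

    L≈RHS : ∀ a → L a ≈ (A a + B a) - T a
    L≈RHS = recurrence-unique L-recurrence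
      (recurrence-sub (recurrence-+ A-recurrence B-recurrence) T-recurrence)
      sources-agree agree-at-0 agree-at-1

lemma5p3 : {c ℓ : Level} (R : CommutativeRing c ℓ) →
    let open CommutativeRing R in
    let open QCalc R in
    (q qi : Carrier) → q * qi ≈ 1# →
    (a d z : ℕ) → .{{NonZero a}} → .{{NonZero d}} → .{{NonZero z}} →
    qint (pow q (suc d)) a * qint q d * qint q (z N.+ a)
      ≈ (pow q a * qint (pow q d) a * qint q (d ∸ 1) * qint q z
         + pow q (a ∸ 1) * wt q qi a * qint q (z N.+ d N.* a))
        - (pow q a * ((1# - q) * (1# - qi))
           * sum1 (λ k → wt q qi k * qint (pow q d) (a ∸ k) * qint q (d ∸ 1) * qint q (z N.+ d N.* k)) (a ∸ 1))
-- The identity holds for every a and z; only d ≥ 1 matters, so that [d - 1]_q is [d]_q without its top term.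
lemma5p3 R q qi q*qi≈1 a (suc d-1) z = Theorem.L≈RHS R q qi q*qi≈1 d-1 z a
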